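{- Let $p_1$ be a prime, $r > 1$ an integer with smallest prime factor $r_1$, and $d$ a positive integer, and let $p' = \min(p_1, r_1)$. Suppose $p_1 r^j + j d$ is prime for every $j = 0, 1, \dots, p'-1$. Then there is no integer $m \ge p'$ such that $p_1 r^j + j d$ is prime for all $j = m, m+1, \dots, m + p' - 1$; that is, the sequence $\{p_1 r^j + j d\}_{j = p'}^{\infty}$ contains no run of $p'$ or more consecutive prime terms.
   Context: A GAP of order $k$ inside the sequence $\{p_1 r^j + jd\}$ means $k$ terms at consecutive indices $j$ that are all prime. -}

module Defs where

open import Data.Nat using (ℕ; _+_; _*_; _^_; _≤_)
open import Data.Nat.Divisibility using (_∣_)
open import Data.Nat.Primality using (Prime)
open import Data.Product using (_×_)

IsSmallestPrimeFactor : ℕ → ℕ → Set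
IsSmallestPrimeFactor r₁ r = Prime r₁ × r₁ ∣ r × (∀ q → Prime q → q ∣ r → r₁ ≤ q)

term : ℕ → ℕ → ℕ → ℕ → ℕ
term p₁ r d j = p₁ * r ^ j + j * d

-- Put q = p₁ ⊓ r₁, a prime. For j ≥ 1 it divides p₁ r^j (it divides p₁ or r), so whenever q ∣ j
-- it divides p₁ r^j + j d, which exceeds p₁ ≥ q; such a term is not prime. Any q consecutive
-- indices contain a multiple of q, and beyond index q it is positive.
{-# OPTIONS --safe #-}
module Submission where

open import Defs
open import Data.Nat using (ℕ; zero; suc; _+_; _*_; _^_; _∸_; _<_; _≤_; _⊓_; z≤n; s≤s; NonZero; >-nonZero)
open import Data.Nat.Properties
open import Data.Nat.Divisibility using (_∣_; _∣0; ∣-refl; ∣m⇒∣m*n; ∣n⇒∣m*n; ∣m∣n⇒∣m+n)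
open import Data.Nat.Primality using (Prime; prime⇒irreducible)
open import Data.Product using (∃-syntax; _×_; _,_)
open import Data.Sum using (_⊎_; inj₁; inj₂; [_,_]′)
open import Relation.Nullary using (¬_)
open import Relation.Binary.PropositionalEquality using (_≡_; sym; trans; cong; subst)

prime⇒1< : ∀ {p} → Prime p → 1 < p
prime⇒1< {suc (suc _)} _ = s≤s (s≤s z≤n)

⊓-pres-Prime : ∀ {m n} → Prime m → Prime n → Prime (m ⊓ n)
⊓-pres-Prime {m} {n} pm pn =
  [ (λ e → subst Prime (sym e) pm) , (λ e → subst Prime (sym e) pn) ]′ (⊓-sel m n)

m⊓n∣a⊎m⊓n∣b : ∀ {m n a b} → m ∣ a → n ∣ b → m ⊓ n ∣ a ⊎ m ⊓ n ∣ b
m⊓n∣a⊎m⊓n∣b {m} {n} m∣a n∣b with ⊓-sel m n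
... | inj₁ e = inj₁ (subst (_∣ _) (sym e) m∣a)
... | inj₂ e = inj₂ (subst (_∣ _) (sym e) n∣b)

multiple-in-window : ∀ q m → 0 < q → ∃[ i ] (i < q × q ∣ m + i)
multiple-in-window q zero    0<q = 0 , 0<q , q ∣0
multiple-in-window q (suc m) 0<q with multiple-in-window q m 0<q
... | suc i , i<q , q∣m+1+i = i , <-trans (n<1+n i) i<q , subst (q ∣_) (+-suc m i) q∣m+1+i
... | zero  , _   , q∣m+0   = q ∸ 1 , ∸-monoʳ-< {q} (s≤s z≤n) 0<q , subst (q ∣_) m+q≡1+m+[q∸1] q∣m+q
  where
    q∣m+q : q ∣ m + q
    q∣m+q = ∣m∣n⇒∣m+n (subst (q ∣_) (+-identityʳ m) q∣m+0) ∣-refl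
    m+q≡1+m+[q∸1] : m + q ≡ suc m + (q ∸ 1)
    m+q≡1+m+[q∸1] = trans (cong (m +_) (sym (m+[n∸m]≡n 0<q))) (+-suc m (q ∸ 1))

module _ {p₁ r d : ℕ} (1<r : 1 < r) where

  private instance
    r≢0 : NonZero r
    r≢0 = >-nonZero (<-trans (s≤s z≤n) 1<r)

  p₁<term-suc : ∀ k → 0 < p₁ → p₁ < term p₁ r d (suc k)
  p₁<term-suc k 0<p₁ = begin-strict
    p₁               <⟨ m<m*n p₁ r 1<r ⟩
    p₁ * r           ≤⟨ *-monoʳ-≤ p₁ (m≤m*n r (r ^ k)) ⟩
    p₁ * r ^ suc k   ≤⟨ m≤m+n _ _ ⟩
    term p₁ r d (suc k) ∎
    where
      open ≤-Reasoning
      instance _ = >-nonZero 0<p₁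
      instance _ = >-nonZero (m^n>0 r k)

  term-not-prime : ∀ {q j} → 1 < q → q ≤ p₁ → q ∣ p₁ ⊎ q ∣ r → q ∣ j → 0 < j →
                   ¬ Prime (term p₁ r d j)
  term-not-prime {q} {suc k} 1<q q≤p₁ q∣p₁⊎r q∣j _ prime-term
    with prime⇒irreducible prime-term (∣m∣n⇒∣m+n q∣p₁r^j (∣m⇒∣m*n d q∣j))
    where
      q∣p₁r^j : q ∣ p₁ * r ^ suc k
      q∣p₁r^j = [ ∣m⇒∣m*n (r ^ suc k) , (λ q∣r → ∣n⇒∣m*n p₁ (∣m⇒∣m*n (r ^ k) q∣r)) ]′ q∣p₁⊎r
  ... | inj₁ q≡1    = <-irrefl (sym q≡1) 1<q
  ... | inj₂ q≡term = <-irrefl q≡term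
                        (≤-<-trans q≤p₁ (p₁<term-suc k (<-trans (s≤s z≤n) (<-≤-trans 1<q q≤p₁))))

theorem3 : (p₁ r r₁ d : ℕ) → Prime p₁ → 1 < r → IsSmallestPrimeFactor r₁ r → 0 < d →
    (∀ j → j < p₁ ⊓ r₁ → Prime (term p₁ r d j)) →
    ¬ (∃[ m ] (p₁ ⊓ r₁ ≤ m × (∀ i → i < p₁ ⊓ r₁ → Prime (term p₁ r d (m + i)))))
theorem3 p₁ r r₁ d p₁-prime 1<r (r₁-prime , r₁∣r , _) _ _ (m , q≤m , window-prime) =
  let i , i<q , q∣m+i = multiple-in-window q m 0<q
  in term-not-prime 1<r 1<q (m⊓n≤m p₁ r₁) (m⊓n∣a⊎m⊓n∣b ∣-refl r₁∣r) q∣m+i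
       (<-≤-trans 0<q (≤-trans q≤m (m≤m+n m i))) (window-prime i i<q)
  where
    q : ℕ
    q = p₁ ⊓ r₁
    1<q : 1 < q
    1<q = prime⇒1< (⊓-pres-Prime p₁-prime r₁-prime)
    0<q : 0 < q
    0<q = <-trans (s≤s z≤n) 1<q
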